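{- Every pure shifted simplicial complex is strongly shellable.
   Context: A simplicial complex is a finite family of subsets of a vertex set closed under taking subsets; $\mathcal{F}(\Delta)$ is its set of facets; it is pure if all facets have the same cardinality. A simplicial complex $\Delta$ on $[n]$ is shifted if for each $F\in\Delta$, each $i\in F$ and each $j\in[n]$ with $j>i$, one has $(F\setminus\{i\})\cup\{j\}\in\Delta$. A linear order $F_1,\dots,F_t$ of $\mathcal{F}(\Delta)$ is a strong shelling order if for every $1\le i<j\le t$ there exists $k$ with $1\le k<j$ such that $|F_j\setminus F_k|=1$, $F_j\setminus F_k\subseteq F_j\setminus F_i$, and $F_k\setminus F_j\subseteq F_i$; $\Delta$ is strongly shellable if such an order exists. -}

module Defs where

open import Data.Nat using (ℕ)
open import Data.Bool using (Bool; T)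
open import Data.Fin using (Fin; _<_)
open import Data.Fin.Subset using (Subset; _⊆_; _∈_; _∪_; _─_; _-_; ⁅_⁆; ∣_∣)
open import Data.List using (List; length; lookup)
open import Data.List.Relation.Unary.Unique.Propositional using (Unique)
import Data.List.Membership.Propositional as LM
open import Data.Product using (Σ; ∃; _×_)
open import Relation.Binary.PropositionalEquality using (_≡_)
open import Function.Bundles using (_⇔_)

-- A family of subsets of the vertex set [n] = Fin n, given by a
-- (decidable) membership test; finite since Subset n is finite.
Family : ℕ → Set
Family n = Subset n → Bool

Face : ∀ {n} → Family n → Subset n → Set
Face Δ F = T (Δ F)

IsSimplicialComplex : ∀ {n} → Family n → Set
IsSimplicialComplex {n} Δ = ∀ (F G : Subset n) → G ⊆ F → Face Δ F → Face Δ G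

IsFacet : ∀ {n} → Family n → Subset n → Set
IsFacet {n} Δ F = Face Δ F × (∀ (G : Subset n) → F ⊆ G → Face Δ G → G ≡ F)

IsPure : ∀ {n} → Family n → Set
IsPure {n} Δ = ∀ (F G : Subset n) → IsFacet Δ F → IsFacet Δ G → ∣ F ∣ ≡ ∣ G ∣

IsShifted : ∀ {n} → Family n → Set
IsShifted {n} Δ = ∀ (F : Subset n) (i j : Fin n) →
  Face Δ F → i ∈ F → i < j → Face Δ ((F - i) ∪ ⁅ j ⁆)

IsFacetOrder : ∀ {n} → Family n → List (Subset n) → Set
IsFacetOrder {n} Δ L = Unique L × (∀ (F : Subset n) → (F LM.∈ L) ⇔ IsFacet Δ F)

IsStrongShellingList : ∀ {n} → List (Subset n) → Set
IsStrongShellingList L =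
  ∀ (i j : Fin (length L)) → i < j →
    Σ (Fin (length L)) λ k → k < j ×
      (∣ lookup L j ─ lookup L k ∣ ≡ 1) ×
      ((lookup L j ─ lookup L k) ⊆ (lookup L j ─ lookup L i)) ×
      ((lookup L k ─ lookup L j) ⊆ lookup L i)

IsStrongShellingOrder : ∀ {n} → Family n → List (Subset n) → Set
IsStrongShellingOrder Δ L = IsFacetOrder Δ L × IsStrongShellingList L

IsStronglyShellable : ∀ {n} → Family n → Set
IsStronglyShellable {n} Δ = ∃ λ (L : List (Subset n)) → IsStrongShellingOrder Δ L

-- List the facets so that F precedes G when the largest vertex at which they
-- differ lies in F. If F_i precedes F_j, purity makes them equally large, so
-- there are vertices a < b with a ∈ F_j ∖ F_i and b ∈ F_i ∖ F_j. Shiftedness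
-- makes F_k = (F_j ∖ {a}) ∪ {b} a face, purity a facet, and F_k precedes F_j
-- because b is the largest vertex at which they differ. Then F_j ∖ F_k = {a}
-- and F_k ∖ F_j = {b}, which are the strong shelling conditions for i < j.
module Submission where

open import Data.Nat using (ℕ; zero; suc; _≤_; z≤n; s≤s)
open import Data.Nat.Properties using (≤-reflexive; ≤-trans; n≤1+n; 1+n≰n; <⇒≱)
open import Data.Bool using (T?)
open import Data.Fin using (Fin; _<_)
open import Data.Fin.Properties using (<-cmp; <-irrefl; <-trans; _≟_)
open import Data.Fin.Subset
  using (Subset; inside; outside; _⊆_; _⊂_; _⊃_; _∈_; _∉_; _∪_; _─_; _-_; ⁅_⁆; ∣_∣)
open import Data.Fin.Subset.Properties
open import Data.Fin.Subset.Induction using (⊃-wellFounded)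
open import Data.Vec using ([]; _∷_; here; there)
open import Data.List using (List; []; _∷_; lookup; filter)
open import Data.List.Membership.Propositional using () renaming (_∈_ to _∈ₗ_)
open import Data.List.Membership.Propositional.Properties using (∈-lookup; ∈-filter⁺; ∈-filter⁻)
open import Data.List.Relation.Unary.Any using (here; there; index)
open import Data.List.Relation.Unary.Any.Properties using (lookup-index)
open import Data.List.Relation.Unary.All as All using (All; []; _∷_)
open import Data.List.Relation.Unary.AllPairs as AllPairs using (AllPairs; []; _∷_)
import Data.List.Relation.Unary.AllPairs.Properties as AllPairs
open import Data.Product using (∃; _×_; _,_; proj₁; proj₂)
open import Data.Sum using (_⊎_; inj₁; inj₂; [_,_]′)
open import Function using (_∘_)
open import Function.Bundles using (_⇔_; mk⇔; Equivalence)
open import Induction.WellFounded using (Acc; acc)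
open import Relation.Binary.Definitions using (tri<; tri≈; tri>)
open import Relation.Binary.PropositionalEquality using (_≡_; _≢_; refl; sym; trans; cong; subst)
open import Relation.Nullary using (¬_; yes; no; contradiction)
open import Relation.Nullary.Decidable using (_×-dec_; ¬?)
import Relation.Nullary.Decidable as Dec
open import Relation.Unary using (Decidable)

open import Defs

open Equivalence using (to; from)

private
  variable
    n : ℕ

x∈p⇒suc∣p-x∣≡∣p∣ : ∀ (p : Subset n) {x} → x ∈ p → suc ∣ p - x ∣ ≡ ∣ p ∣
x∈p⇒suc∣p-x∣≡∣p∣ (inside ∷ p) here = cong suc (cong ∣_∣ (p─⊥≡p p))
x∈p⇒suc∣p-x∣≡∣p∣ (inside ∷ p) (there x∈p) = cong suc (x∈p⇒suc∣p-x∣≡∣p∣ p x∈p)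
x∈p⇒suc∣p-x∣≡∣p∣ (outside ∷ p) (there x∈p) = x∈p⇒suc∣p-x∣≡∣p∣ p x∈p

x∉p⇒∣p∪⁅x⁆∣≡suc∣p∣ : ∀ (p : Subset n) x → x ∉ p → ∣ p ∪ ⁅ x ⁆ ∣ ≡ suc ∣ p ∣
x∉p⇒∣p∪⁅x⁆∣≡suc∣p∣ (inside ∷ p) Fin.zero x∉p = contradiction here x∉p
x∉p⇒∣p∪⁅x⁆∣≡suc∣p∣ (outside ∷ p) Fin.zero x∉p = cong suc (cong ∣_∣ (∪-identityʳ p))
x∉p⇒∣p∪⁅x⁆∣≡suc∣p∣ (inside ∷ p) (Fin.suc x) x∉p =
  cong suc (x∉p⇒∣p∪⁅x⁆∣≡suc∣p∣ p x (x∉p ∘ there))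
x∉p⇒∣p∪⁅x⁆∣≡suc∣p∣ (outside ∷ p) (Fin.suc x) x∉p = x∉p⇒∣p∪⁅x⁆∣≡suc∣p∣ p x (x∉p ∘ there)

p⊆q∧∣q∣≤∣p∣⇒p≡q : ∀ {p q : Subset n} → p ⊆ q → ∣ q ∣ ≤ ∣ p ∣ → p ≡ q
p⊆q∧∣q∣≤∣p∣⇒p≡q {p = p} p⊆q ∣q∣≤∣p∣ = ⊆-antisym p⊆q q⊆p
  where
  q⊆p : _ ⊆ p
  q⊆p {x} x∈q with x ∈? p
  ... | yes x∈p = x∈p
  ... | no x∉p = contradiction ∣q∣≤∣p∣ (<⇒≱ (p⊂q⇒∣p∣<∣q∣ (p⊆q , x , x∈q , x∉p)))

x∈p─q⇒x∉q : ∀ (p q : Subset n) {x} → x ∈ p ─ q → x ∉ q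
x∈p─q⇒x∉q (inside ∷ p) (outside ∷ q) here = λ ()
x∈p─q⇒x∉q (_ ∷ p) (_ ∷ q) (there x∈p─q) (there x∈q) = x∈p─q⇒x∉q p q x∈p─q x∈q

-- p ≺ q : at the largest vertex where p and q differ, p is inside and q is outside.
data _≺_ : Subset n → Subset n → Set where
  at-head : ∀ {p : Subset n} → (inside ∷ p) ≺ (outside ∷ p)
  in-tail : ∀ {x y} {p q : Subset n} → p ≺ q → (x ∷ p) ≺ (y ∷ q)

≺-irrefl : ∀ {p : Subset n} → ¬ (p ≺ p)
≺-irrefl (in-tail p≺p) = ≺-irrefl p≺p

≺-trans : ∀ {p q r : Subset n} → p ≺ q → q ≺ r → p ≺ r
≺-trans at-head (in-tail q≺r) = in-tail q≺r
≺-trans (in-tail p≺q) at-head = in-tail p≺q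
≺-trans (in-tail p≺q) (in-tail q≺r) = in-tail (≺-trans p≺q q≺r)

≺-witness : ∀ {p q : Subset n} → p ≺ q → ∃ λ b → b ∈ p × b ∉ q
≺-witness at-head = Fin.zero , here , λ ()
≺-witness (in-tail p≺q) with ≺-witness p≺q
... | b , b∈p , b∉q = Fin.suc b , there b∈p , b∉q ∘ drop-there

AgreeAbove : Fin n → Subset n → Subset n → Set
AgreeAbove b p q = ∀ {x} → b < x → x ∈ p ⇔ x ∈ q

≺-intro : ∀ {p q : Subset n} {b} → b ∈ p → b ∉ q → AgreeAbove b p q → p ≺ q
≺-intro {q = inside ∷ q} here b∉q agree = contradiction here b∉q
≺-intro {p = inside ∷ p} {q = outside ∷ q} here b∉q agree
  rewrite ⊆-antisym {i = p} {j = q} (drop-there ∘ to (agree (s≤s z≤n)) ∘ there)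
                                    (drop-there ∘ from (agree (s≤s z≤n)) ∘ there)
  = at-head
≺-intro {q = _ ∷ _} (there b∈p) b∉q agree =
  in-tail (≺-intro b∈p (b∉q ∘ there) λ b<x →
    mk⇔ (drop-there ∘ to (agree (s≤s b<x)) ∘ there) (drop-there ∘ from (agree (s≤s b<x)) ∘ there))

record Exchange (p q : Subset n) : Set where
  field
    {a b} : Fin n
    a<b : a < b
    a∈q : a ∈ q
    a∉p : a ∉ p
    b∈p : b ∈ p
    b∉q : b ∉ q

exchange-∷ : ∀ {x y} {p q : Subset n} → Exchange p q → Exchange (x ∷ p) (y ∷ q)
exchange-∷ e = record
  { a<b = s≤s a<b ; a∈q = there a∈q ; a∉p = a∉p ∘ drop-there
  ; b∈p = there b∈p ; b∉q = b∉q ∘ drop-there }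
  where open Exchange e

≺-exchange : ∀ {p q : Subset n} → p ≺ q → ∣ p ∣ ≤ ∣ q ∣ → Exchange p q
≺-exchange at-head ∣p∣≤∣q∣ = contradiction ∣p∣≤∣q∣ 1+n≰n
≺-exchange (in-tail {x = inside} {y = inside} p≺q) (s≤s ∣p∣≤∣q∣) = exchange-∷ (≺-exchange p≺q ∣p∣≤∣q∣)
≺-exchange (in-tail {x = outside} {y = outside} p≺q) ∣p∣≤∣q∣ = exchange-∷ (≺-exchange p≺q ∣p∣≤∣q∣)
≺-exchange (in-tail {x = inside} {y = outside} {p = p} p≺q) ∣p∣<∣q∣ =
  exchange-∷ (≺-exchange p≺q (≤-trans (n≤1+n ∣ p ∣) ∣p∣<∣q∣))
≺-exchange (in-tail {x = outside} {y = inside} p≺q) _ with ≺-witness p≺q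
... | b , b∈p , b∉q = record
  { a<b = s≤s z≤n ; a∈q = here ; a∉p = λ () ; b∈p = there b∈p ; b∉q = b∉q ∘ drop-there }

both∷ : List (Subset n) → List (Subset (suc n))
both∷ [] = []
both∷ (p ∷ ps) = (inside ∷ p) ∷ (outside ∷ p) ∷ both∷ ps

allSubsets : ∀ n → List (Subset n)
allSubsets zero = [] ∷ []
allSubsets (suc n) = both∷ (allSubsets n)

∈-both∷ : ∀ x {p : Subset n} {ps} → p ∈ₗ ps → (x ∷ p) ∈ₗ both∷ ps
∈-both∷ inside {ps = _ ∷ _} (here refl) = here refl
∈-both∷ outside {ps = _ ∷ _} (here refl) = there (here refl)
∈-both∷ x {ps = _ ∷ ps} (there p∈ps) = there (there (∈-both∷ x p∈ps))

∈-allSubsets : ∀ (p : Subset n) → p ∈ₗ allSubsets n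
∈-allSubsets [] = here refl
∈-allSubsets (x ∷ p) = ∈-both∷ x (∈-allSubsets p)

both∷-sorted : ∀ {ps : List (Subset n)} → AllPairs _≺_ ps → AllPairs _≺_ (both∷ ps)
both∷-sorted [] = []
both∷-sorted (p≺ps ∷ ps-sorted) =
  (at-head ∷ cons-≺-both∷ p≺ps) ∷ cons-≺-both∷ p≺ps ∷ both∷-sorted ps-sorted
  where
  cons-≺-both∷ : ∀ {x} {p : Subset n} {ps} → All (p ≺_) ps → All ((x ∷ p) ≺_) (both∷ ps)
  cons-≺-both∷ [] = []
  cons-≺-both∷ (p≺q ∷ p≺qs) = in-tail p≺q ∷ in-tail p≺q ∷ cons-≺-both∷ p≺qs

allSubsets-sorted : ∀ n → AllPairs _≺_ (allSubsets n)
allSubsets-sorted zero = [] ∷ []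
allSubsets-sorted (suc n) = both∷-sorted (allSubsets-sorted n)

sorted-enumeration : ∀ {P : Subset n → Set} → Decidable P →
  ∃ λ (L : List (Subset n)) → AllPairs _≺_ L × (∀ p → p ∈ₗ L ⇔ P p)
sorted-enumeration {n} P? =
  filter P? (allSubsets n) ,
  AllPairs.filter⁺ P? (allSubsets-sorted n) ,
  λ p → mk⇔ (proj₂ ∘ ∈-filter⁻ P? {xs = allSubsets n}) (∈-filter⁺ P? (∈-allSubsets p))

lookup-AllPairs : ∀ {A : Set} {R : A → A → Set} {xs : List A} → AllPairs R xs →
  ∀ {i j} → i < j → R (lookup xs i) (lookup xs j)
lookup-AllPairs (Rx ∷ _) {Fin.zero} {Fin.suc j} _ = All.lookup Rx (∈-lookup j)
lookup-AllPairs (_ ∷ sorted) {Fin.suc i} {Fin.suc j} (s≤s i<j) = lookup-AllPairs sorted i<j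

lookup-≺⇒< : ∀ {L : List (Subset n)} → AllPairs _≺_ L →
  ∀ {k j} → lookup L k ≺ lookup L j → k < j
lookup-≺⇒< sorted {k} {j} Lk≺Lj with <-cmp k j
... | tri< k<j _ _ = k<j
... | tri≈ _ refl _ = contradiction Lk≺Lj ≺-irrefl
... | tri> _ _ j<k = contradiction (≺-trans Lk≺Lj (lookup-AllPairs sorted j<k)) ≺-irrefl

shift : Subset n → Fin n → Fin n → Subset n
shift q a b = (q - a) ∪ ⁅ b ⁆

module _ {q : Subset n} {a b : Fin n} where

  ∈-shift⁻ : ∀ {x} → x ∈ shift q a b → (x ∈ q × x ≢ a) ⊎ x ≡ b
  ∈-shift⁻ x∈ with x∈p∪q⁻ (q - a) ⁅ b ⁆ x∈
  ... | inj₁ x∈q-a = inj₁ (p─q⊆p q ⁅ a ⁆ x∈q-a , x∉⁅y⁆⇒x≢y (x∈p─q⇒x∉q q ⁅ a ⁆ x∈q-a))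
  ... | inj₂ x∈⁅b⁆ = inj₂ (x∈⁅y⁆⇒x≡y b x∈⁅b⁆)

  ∈-shift⁺ : ∀ {x} → x ∈ q → x ≢ a → x ∈ shift q a b
  ∈-shift⁺ x∈q x≢a = x∈p∪q⁺ (inj₁ (x∈p∧x≢y⇒x∈p-y x∈q x≢a))

  b∈shift : b ∈ shift q a b
  b∈shift = x∈p∪q⁺ (inj₂ (x∈⁅x⁆ b))

  a∉shift : a < b → a ∉ shift q a b
  a∉shift a<b a∈ with ∈-shift⁻ a∈
  ... | inj₁ (_ , a≢a) = a≢a refl
  ... | inj₂ refl = <-irrefl refl a<b

  ∣shift∣≡∣q∣ : a ∈ q → b ∉ q → ∣ shift q a b ∣ ≡ ∣ q ∣
  ∣shift∣≡∣q∣ a∈q b∉q =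
    trans (x∉p⇒∣p∪⁅x⁆∣≡suc∣p∣ (q - a) b (b∉q ∘ p─q⊆p q ⁅ a ⁆)) (x∈p⇒suc∣p-x∣≡∣p∣ q a∈q)

  shift≺ : a < b → b ∉ q → shift q a b ≺ q
  shift≺ a<b b∉q = ≺-intro b∈shift b∉q λ b<x →
    mk⇔ (λ x∈ → [ proj₁ , (λ { refl → contradiction b<x (<-irrefl refl) }) ]′ (∈-shift⁻ x∈))
        (λ x∈q → ∈-shift⁺ x∈q λ { refl → <-irrefl refl (<-trans a<b b<x) })

  q─shift⊆⁅a⁆ : ∀ {x} → x ∈ q ─ shift q a b → x ≡ a
  q─shift⊆⁅a⁆ {x} x∈ with x ≟ a
  ... | yes x≡a = x≡a
  ... | no x≢a = contradiction (∈-shift⁺ (p─q⊆p q _ x∈) x≢a) (x∈p─q⇒x∉q q _ x∈)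

  shift─q⊆⁅b⁆ : ∀ {x} → x ∈ shift q a b ─ q → x ≡ b
  shift─q⊆⁅b⁆ x∈ with ∈-shift⁻ (p─q⊆p _ q x∈)
  ... | inj₁ (x∈q , _) = contradiction x∈q (x∈p─q⇒x∉q _ q x∈)
  ... | inj₂ x≡b = x≡b

  q─shift≡⁅a⁆ : a ∈ q → a < b → q ─ shift q a b ≡ ⁅ a ⁆
  q─shift≡⁅a⁆ a∈q a<b = ⊆-antisym
    (λ x∈ → subst (_∈ ⁅ a ⁆) (sym (q─shift⊆⁅a⁆ x∈)) (x∈⁅x⁆ a))
    (λ x∈⁅a⁆ → subst (_∈ q ─ shift q a b) (sym (x∈⁅y⁆⇒x≡y a x∈⁅a⁆))
                 (x∈p∧x∉q⇒x∈p─q a∈q (a∉shift a<b)))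

StrongShellingStep : (p q k : Subset n) → Set
StrongShellingStep p q k = (∣ q ─ k ∣ ≡ 1) × (q ─ k ⊆ q ─ p) × (k ─ q ⊆ p)

shift-strongShellingStep : ∀ {p q : Subset n} (e : Exchange p q) →
  let open Exchange e in StrongShellingStep p q (shift q a b)
shift-strongShellingStep {p = p} {q} e =
  trans (cong ∣_∣ (q─shift≡⁅a⁆ a∈q a<b)) (∣⁅x⁆∣≡1 a) ,
  (λ x∈ → subst (_∈ q ─ p) (sym (q─shift⊆⁅a⁆ x∈)) (x∈p∧x∉q⇒x∈p─q a∈q a∉p)) ,
  (λ x∈ → subst (_∈ p) (sym (shift─q⊆⁅b⁆ x∈)) b∈p)
  where open Exchange e

module _ (Δ : Family n) where

  HasFaceAbove : Subset n → Set
  HasFaceAbove F = ∃ λ K → F ⊂ K × Face Δ K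

  hasFaceAbove? : Decidable HasFaceAbove
  hasFaceAbove? F = anySubset? λ K → (F ⊂? K) ×-dec T? (Δ K)

  maximal⇒facet : ∀ {F} → Face Δ F → ¬ HasFaceAbove F → IsFacet Δ F
  maximal⇒facet {F} F∈Δ noneAbove = F∈Δ , λ G F⊆G G∈Δ → ⊆-antisym (G⊆F F⊆G G∈Δ) F⊆G
    where
    G⊆F : ∀ {G} → F ⊆ G → Face Δ G → G ⊆ F
    G⊆F {G} F⊆G G∈Δ {x} x∈G with x ∈? F
    ... | yes x∈F = x∈F
    ... | no x∉F = contradiction (G , ((λ {y} → F⊆G {y}) , x , x∈G , x∉F) , G∈Δ) noneAbove

  facet⇒maximal : ∀ {F} → IsFacet Δ F → ¬ HasFaceAbove F
  facet⇒maximal (_ , maximal) (K , (F⊆K , x , x∈K , x∉F) , K∈Δ) =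
    x∉F (subst (x ∈_) (maximal K F⊆K K∈Δ) x∈K)

  isFacet? : Decidable (IsFacet Δ)
  isFacet? F = Dec.map (mk⇔ (λ (F∈Δ , noneAbove) → maximal⇒facet F∈Δ noneAbove)
                            (λ facet → proj₁ facet , facet⇒maximal facet))
                       (T? (Δ F) ×-dec ¬? (hasFaceAbove? F))

  facet-above : ∀ {F} → Face Δ F → ∃ λ H → IsFacet Δ H × F ⊆ H
  facet-above {F} F∈Δ = go F∈Δ (⊃-wellFounded F)
    where
    go : ∀ {F} → Face Δ F → Acc _⊃_ F → ∃ λ H → IsFacet Δ H × F ⊆ H
    go {F} F∈Δ (acc rec) with hasFaceAbove? F
    ... | no noneAbove = F , maximal⇒facet F∈Δ noneAbove , λ x∈F → x∈F
    ... | yes (K , F⊂K , K∈Δ) with go K∈Δ (rec F⊂K)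
    ...   | H , facetH , K⊆H = H , facetH , K⊆H ∘ p⊂q⇒p⊆q F⊂K

  face-of-facet-size⇒facet : IsPure Δ → ∀ {Q G} →
    IsFacet Δ Q → Face Δ G → ∣ G ∣ ≡ ∣ Q ∣ → IsFacet Δ G
  face-of-facet-size⇒facet pure {Q} facetQ G∈Δ ∣G∣≡∣Q∣ with facet-above G∈Δ
  ... | H , facetH , G⊆H = subst (IsFacet Δ) (sym G≡H) facetH
    where
    G≡H : _ ≡ H
    G≡H = p⊆q∧∣q∣≤∣p∣⇒p≡q G⊆H (≤-reflexive (trans (pure _ Q facetH facetQ) (sym ∣G∣≡∣Q∣)))

  sorted-facets-strongShelling : IsPure Δ → IsShifted Δ → ∀ {L} → AllPairs _≺_ L →
    (∀ F → F ∈ₗ L ⇔ IsFacet Δ F) → IsStrongShellingList L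
  sorted-facets-strongShelling pure shifted {L} sorted facets i j i<j =
    index G∈L , lookup-≺⇒< sorted (subst (_≺ Q) (lookup-index G∈L) (shift≺ a<b b∉q)) ,
    subst (StrongShellingStep P Q) (lookup-index G∈L) (shift-strongShellingStep e)
    where
    P Q : Subset n
    P = lookup L i
    Q = lookup L j
    facetP : IsFacet Δ P
    facetP = to (facets P) (∈-lookup i)
    facetQ : IsFacet Δ Q
    facetQ = to (facets Q) (∈-lookup j)
    e : Exchange P Q
    e = ≺-exchange (lookup-AllPairs sorted i<j) (≤-reflexive (pure P Q facetP facetQ))
    open Exchange e
    facetG : IsFacet Δ (shift Q a b)
    facetG = face-of-facet-size⇒facet pure facetQ
               (shifted Q a b (proj₁ facetQ) a∈q a<b) (∣shift∣≡∣q∣ a∈q b∉q)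
    G∈L : shift Q a b ∈ₗ L
    G∈L = from (facets _) facetG

proposition6p5 : (n : ℕ) (Δ : Family n) →
    IsSimplicialComplex Δ → IsPure Δ → IsShifted Δ → IsStronglyShellable Δ
proposition6p5 n Δ _ pure shifted with sorted-enumeration (isFacet? Δ)
... | L , sorted , facets =
  L , (AllPairs.map (λ F≺G F≡G → ≺-irrefl (subst (_≺ _) F≡G F≺G)) sorted , facets) ,
  sorted-facets-strongShelling Δ pure shifted sorted facets
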